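{- If $G$ is a strictly $\mathscr{P}$-free game and $k\in\mathbb{Z}$, then $G+k$ is also strictly $\mathscr{P}$-free.
   Context: Games are short misère-play game forms, possibly augmented in Siegel's sense (subpositions may carry Left and/or Right tombstones; a Left (Right) tombstone means Left (Right) wins moving first there). Outcomes $o(G)\in\{\mathscr{L},\mathscr{N},\mathscr{P},\mathscr{R}\}$ ($\mathscr{P}$: second player wins). $+$ is disjunctive sum; $0=\{\cdot\mid\cdot\}$; for $n\ge1$ the integer $n$ is $\{n-1\mid\cdot\}$ and $\overline{n}$ is its conjugate; for $k<0$, $G+k$ means $G+\overline{ -k}$. A subposition of $G$ is any game reachable by a possibly empty, not necessarily alternating, sequence of moves; $G$ is strictly $\mathscr{P}$-free if no subposition (including $G$) has outcome $\mathscr{P}$. -}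

module Defs where

open import Data.Bool using (Bool; true; false; _∨_; not)
open import Data.List using (List; []; _∷_; _++_)
open import Data.List.Membership.Propositional using (_∈_)
open import Data.Integer using (ℤ; +_; -[1+_])
open import Data.Nat using (ℕ; zero; suc)
open import Relation.Binary.PropositionalEquality using (_≢_)

-- Augmented short game forms (Siegel):
--   game tL tR ls rs
-- tL = true  : the form carries a Left tombstone (Left wins moving first here)
-- tR = true  : the form carries a Right tombstone (Right wins moving first here)
-- ls, rs     : the (finite) lists of Left and Right options.
data Game : Set where
  game : Bool → Bool → List Game → List Game → Game

-- Misère play: a player wins moving first iff they have a tombstone there,
-- or they have no options (misère convention), or they have an option
-- from which the opponent (now moving first) does not win.
mutual
  leftWinsFirst : Game → Bool
  leftWinsFirst (game tL tR [] rs) = true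
  leftWinsFirst (game tL tR (l ∷ ls) rs) = tL ∨ someRightLoses (l ∷ ls)

  rightWinsFirst : Game → Bool
  rightWinsFirst (game tL tR ls []) = true
  rightWinsFirst (game tL tR ls (r ∷ rs)) = tR ∨ someLeftLoses (r ∷ rs)

  someRightLoses : List Game → Bool
  someRightLoses [] = false
  someRightLoses (g ∷ gs) = not (rightWinsFirst g) ∨ someRightLoses gs

  someLeftLoses : List Game → Bool
  someLeftLoses [] = false
  someLeftLoses (g ∷ gs) = not (leftWinsFirst g) ∨ someLeftLoses gs

data Outcome : Set where
  𝓛 𝓝 𝓟 𝓡 : Outcome

outcome : Game → Outcome
outcome g with leftWinsFirst g | rightWinsFirst g
... | true  | true  = 𝓝
... | true  | false = 𝓛
... | false | true  = 𝓡
... | false | false = 𝓟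

mutual
  _⊕_ : Game → Game → Game
  game a b ls rs ⊕ game c d ls' rs' =
    game (a ∨ c) (b ∨ d)
      (addLeft ls (game c d ls' rs') ++ addRight (game a b ls rs) ls')
      (addLeft rs (game c d ls' rs') ++ addRight (game a b ls rs) rs')

  addLeft : List Game → Game → List Game
  addLeft [] h = []
  addLeft (x ∷ xs) h = (x ⊕ h) ∷ addLeft xs h

  addRight : Game → List Game → List Game
  addRight g [] = []
  addRight g (y ∷ ys) = (g ⊕ y) ∷ addRight g ys

mutual
  conj : Game → Game
  conj (game a b ls rs) = game b a (conjList rs) (conjList ls)

  conjList : List Game → List Game
  conjList [] = []
  conjList (g ∷ gs) = conj g ∷ conjList gs

natGame : ℕ → Game
natGame zero = game false false [] []
natGame (suc n) = game false false (natGame n ∷ []) []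

intGame : ℤ → Game
intGame (+ n) = natGame n
intGame -[1+ n ] = conj (natGame (suc n))

data Subposition : Game → Game → Set where
  here  : ∀ {g} → Subposition g g
  viaL  : ∀ {a b ls rs x h} → x ∈ ls → Subposition x h → Subposition (game a b ls rs) h
  viaR  : ∀ {a b ls rs x h} → x ∈ rs → Subposition x h → Subposition (game a b ls rs) h

StrictlyPFree : Game → Set
StrictlyPFree g = ∀ h → Subposition g h → outcome h ≢ 𝓟

-- Adding 1 to a game only gives Left one more move, which in misère play cannot help Left.
-- Precisely, for strictly 𝓟-free g, with winning moving first read as a Bool (x ≤ y is implication):
--   rightWinsFirst (g + m) ≤ rightWinsFirst (g + (m+1)),   leftWinsFirst (g + (m+1)) ≤ leftWinsFirst (g + m). The Left options of g + (m+1) are the g^L + (m+1), handled by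
-- induction, and g + m, from which Right wins moving first because g + m is not 𝓟 while Left loses
-- moving first there. That g + m is not 𝓟 is the hypothesis for m = 0; for m+1, if Left loses moving first
-- in g + (m+1), then Right wins moving first in its option g + m, hence by monotonicity in g + (m+1).
-- Subpositions of g + n are the g′ + m with g′ a subposition of g, so g + n is strictly 𝓟-free;
-- negative integers reduce to positive ones by conjugation.

module Submission where

open import Data.Bool using (true; false; not; _∨_; _≤_; b≤b; f≤t)
open import Data.Bool.Properties
  using (≤-refl; ≤-trans; ≤-minimum; ≤-maximum; ∨-identityʳ; ∨-assoc)
open import Data.Integer using (ℤ; +_; -[1+_])
open import Data.List using ([]; _∷_; _++_; [_]; map; null)
open import Data.List.Properties using (++-identityʳ)
open import Data.List.Membership.Propositional using (_∈_)
open import Data.List.Membership.Propositional.Properties using (∈-map⁻; ∈-++⁻)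
open import Data.List.Relation.Unary.All using (All; []; _∷_; tabulate)
open import Data.List.Relation.Unary.Any using (here; there)
open import Data.Nat using (zero; suc)
open import Data.Product using (∃; ∃₂; _×_; _,_)
open import Data.Sum using (_⊎_; inj₁; inj₂)
import Data.Sum as Sum
open import Function.Bundles using (_⇔_; mk⇔; Equivalence)
open import Relation.Binary.PropositionalEquality
  using (_≡_; _≢_; refl; sym; trans; cong; cong₂; subst; subst₂; module ≡-Reasoning)

open import Defs

∨-mono-≤ : ∀ {a b c d} → a ≤ b → c ≤ d → a ∨ c ≤ b ∨ d
∨-mono-≤ {false} {false} _ c≤d = c≤d
∨-mono-≤ {false} {true}  _ _   = ≤-maximum _
∨-mono-≤ {true}  {true}  _ _   = b≤b

∨-monoʳ-≤ : ∀ a {c d} → c ≤ d → a ∨ c ≤ a ∨ d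
∨-monoʳ-≤ a = ∨-mono-≤ (≤-refl {a})

∨-lub : ∀ {a b c} → a ≤ c → b ≤ c → a ∨ b ≤ c
∨-lub {false} _   b≤c = b≤c
∨-lub {true}  a≤c _   = a≤c

x≤x∨y : ∀ x y → x ≤ x ∨ y
x≤x∨y false y = ≤-minimum y
x≤x∨y true  y = b≤b

x≤y∨x : ∀ x y → x ≤ y ∨ x
x≤y∨x x false = ≤-refl
x≤y∨x x true  = ≤-maximum x

not-antimono-≤ : ∀ {a b} → a ≤ b → not b ≤ not a
not-antimono-≤ b≤b = b≤b
not-antimono-≤ f≤t = f≤t

not-≤-swap : ∀ {a b} → not a ≤ b → not b ≤ a
not-≤-swap {true}  _ = ≤-maximum _
not-≤-swap {false} {true} _ = b≤b

someRightLoses-++ : ∀ xs ys → someRightLoses (xs ++ ys) ≡ someRightLoses xs ∨ someRightLoses ys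
someRightLoses-++ []       ys = refl
someRightLoses-++ (x ∷ xs) ys =
  trans (cong (not (rightWinsFirst x) ∨_) (someRightLoses-++ xs ys))
        (sym (∨-assoc (not (rightWinsFirst x)) _ _))

leftWinsFirst-lowerBound : ∀ a b xs rs → a ∨ someRightLoses xs ≤ leftWinsFirst (game a b xs rs)
leftWinsFirst-lowerBound a b []      rs = ≤-maximum _
leftWinsFirst-lowerBound a b (_ ∷ _) rs = ≤-refl

leftWinsFirst-∷ʳ : ∀ a b xs y rs →
  leftWinsFirst (game a b (xs ++ [ y ]) rs) ≡ a ∨ someRightLoses (xs ++ [ y ])
leftWinsFirst-∷ʳ a b []      y rs = refl
leftWinsFirst-∷ʳ a b (_ ∷ _) y rs = refl

outcome≢𝓟⇔ : ∀ g → outcome g ≢ 𝓟 ⇔ not (rightWinsFirst g) ≤ leftWinsFirst g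
outcome≢𝓟⇔ g = mk⇔ to from
  where
  to : outcome g ≢ 𝓟 → not (rightWinsFirst g) ≤ leftWinsFirst g
  to o≢𝓟 with leftWinsFirst g | rightWinsFirst g
  ... | true  | _     = ≤-maximum _
  ... | false | true  = b≤b
  ... | false | false with () ← o≢𝓟 refl

  from : not (rightWinsFirst g) ≤ leftWinsFirst g → outcome g ≢ 𝓟
  from ≤lw with leftWinsFirst g | rightWinsFirst g
  from ≤lw  | true  | true  = λ ()
  from ≤lw  | true  | false = λ ()
  from ≤lw  | false | true  = λ ()
  from ()   | false | false

addLeft-map : ∀ xs h → addLeft xs h ≡ map (_⊕ h) xs
addLeft-map []       h = refl
addLeft-map (x ∷ xs) h = cong (x ⊕ h ∷_) (addLeft-map xs h)

addRight-map : ∀ g ys → addRight g ys ≡ map (g ⊕_) ys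
addRight-map g []       = refl
addRight-map g (y ∷ ys) = cong (g ⊕ y ∷_) (addRight-map g ys)

∈-⊕-options⁻ : ∀ {g h x} xs ys → x ∈ addLeft xs h ++ addRight g ys →
  (∃ λ x′ → x′ ∈ xs × x ≡ x′ ⊕ h) ⊎ (∃ λ y → y ∈ ys × x ≡ g ⊕ y)
∈-⊕-options⁻ {g} {h} xs ys x∈ rewrite addLeft-map xs h | addRight-map g ys =
  Sum.map (∈-map⁻ (_⊕ h)) (∈-map⁻ (g ⊕_)) (∈-++⁻ (map (_⊕ h) xs) x∈)

mutual
  ⊕-identityʳ : ∀ g → g ⊕ natGame 0 ≡ g
  ⊕-identityʳ (game a b ls rs)
    rewrite ∨-identityʳ a | ∨-identityʳ b
          | ++-identityʳ (addLeft ls (natGame 0)) | ++-identityʳ (addLeft rs (natGame 0)) =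
    cong₂ (game a b) (addLeft-identityʳ ls) (addLeft-identityʳ rs)

  addLeft-identityʳ : ∀ xs → addLeft xs (natGame 0) ≡ xs
  addLeft-identityʳ []       = refl
  addLeft-identityʳ (x ∷ xs) = cong₂ _∷_ (⊕-identityʳ x) (addLeft-identityʳ xs)

leftWinsFirst-⊕-lowerBound : ∀ a b ls rs h →
  a ∨ someRightLoses (addLeft ls h) ≤ leftWinsFirst (game a b ls rs ⊕ h)
leftWinsFirst-⊕-lowerBound a b ls rs h@(game c d ls′ rs′) =
  ≤-trans (∨-mono-≤ (x≤x∨y a c)
                    (subst (_ ≤_) (sym (someRightLoses-++ xs ys)) (x≤x∨y _ _)))
          (leftWinsFirst-lowerBound (a ∨ c) (b ∨ d) (xs ++ ys) _)
  where
  xs = addLeft ls h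
  ys = addRight (game a b ls rs) ls′

rightWinsFirst-⊕-natGame : ∀ a b ls rs m →
  rightWinsFirst (game a b ls rs ⊕ natGame m)
    ≡ null rs ∨ (b ∨ someLeftLoses (addLeft rs (natGame m)))
rightWinsFirst-⊕-natGame a b ls [] zero    = refl
rightWinsFirst-⊕-natGame a b ls [] (suc m) = refl
rightWinsFirst-⊕-natGame a b ls (_ ∷ rs) zero
  rewrite ∨-identityʳ b | ++-identityʳ (addLeft rs (natGame 0)) = refl
rightWinsFirst-⊕-natGame a b ls (_ ∷ rs) (suc m)
  rewrite ∨-identityʳ b | ++-identityʳ (addLeft rs (natGame (suc m))) = refl

leftWinsFirst-⊕-natGame-suc : ∀ a b ls rs m →
  leftWinsFirst (game a b ls rs ⊕ natGame (suc m))
    ≡ (a ∨ someRightLoses (addLeft ls (natGame (suc m))))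
      ∨ not (rightWinsFirst (game a b ls rs ⊕ natGame m))
leftWinsFirst-⊕-natGame-suc a b ls rs m = begin
  leftWinsFirst (game (a ∨ false) (b ∨ false) (xs ++ [ y ]) (addLeft rs (natGame (suc m)) ++ []))
    ≡⟨ leftWinsFirst-∷ʳ (a ∨ false) _ xs y _ ⟩
  (a ∨ false) ∨ someRightLoses (xs ++ [ y ])
    ≡⟨ cong₂ _∨_ (∨-identityʳ a) (someRightLoses-++ xs [ y ]) ⟩
  a ∨ (someRightLoses xs ∨ (not (rightWinsFirst y) ∨ false))
    ≡⟨ cong (λ t → a ∨ (someRightLoses xs ∨ t)) (∨-identityʳ _) ⟩
  a ∨ (someRightLoses xs ∨ not (rightWinsFirst y))
    ≡⟨ sym (∨-assoc a _ _) ⟩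
  (a ∨ someRightLoses xs) ∨ not (rightWinsFirst y) ∎
  where
  open ≡-Reasoning
  xs = addLeft ls (natGame (suc m))
  y  = game a b ls rs ⊕ natGame m

Subposition-trans : ∀ {g h k} → Subposition g h → Subposition h k → Subposition g k
Subposition-trans here         q = q
Subposition-trans (viaL x∈ p) q = viaL x∈ (Subposition-trans p q)
Subposition-trans (viaR x∈ p) q = viaR x∈ (Subposition-trans p q)

StrictlyPFree-sub : ∀ {g h} → StrictlyPFree g → Subposition g h → StrictlyPFree h
StrictlyPFree-sub spf p k q = spf k (Subposition-trans p q)

StrictlyPFree-leftOptions : ∀ {a b ls rs} → StrictlyPFree (game a b ls rs) → All StrictlyPFree ls
StrictlyPFree-leftOptions spf = tabulate λ x∈ → StrictlyPFree-sub spf (viaL x∈ here)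

StrictlyPFree-rightOptions : ∀ {a b ls rs} → StrictlyPFree (game a b ls rs) → All StrictlyPFree rs
StrictlyPFree-rightOptions spf = tabulate λ x∈ → StrictlyPFree-sub spf (viaR x∈ here)

Subposition-⊕⁻ : ∀ g h {k} → Subposition (g ⊕ h) k →
  ∃₂ λ g′ h′ → Subposition g g′ × Subposition h h′ × k ≡ g′ ⊕ h′
Subposition-⊕⁻ g@(game _ _ _ _) h@(game _ _ _ _) here = g , h , here , here , refl
Subposition-⊕⁻ g@(game _ _ ls _) h@(game _ _ ls′ _) (viaL x∈ p) with ∈-⊕-options⁻ ls ls′ x∈
... | inj₁ (x , x∈ls , refl) =
  let g′ , h′ , q , r , e = Subposition-⊕⁻ x h p in g′ , h′ , viaL x∈ls q , r , e
... | inj₂ (y , y∈ls′ , refl) =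
  let g′ , h′ , q , r , e = Subposition-⊕⁻ g y p in g′ , h′ , q , viaL y∈ls′ r , e
Subposition-⊕⁻ g@(game _ _ _ rs) h@(game _ _ _ rs′) (viaR x∈ p) with ∈-⊕-options⁻ rs rs′ x∈
... | inj₁ (x , x∈rs , refl) =
  let g′ , h′ , q , r , e = Subposition-⊕⁻ x h p in g′ , h′ , viaR x∈rs q , r , e
... | inj₂ (y , y∈rs′ , refl) =
  let g′ , h′ , q , r , e = Subposition-⊕⁻ g y p in g′ , h′ , q , viaR y∈rs′ r , e

Subposition-natGame⁻ : ∀ n {k} → Subposition (natGame n) k → ∃ λ m → k ≡ natGame m
Subposition-natGame⁻ zero    here                 = zero , refl
Subposition-natGame⁻ (suc n) here                 = suc n , refl
Subposition-natGame⁻ (suc n) (viaL (here refl) p) = Subposition-natGame⁻ n p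

mutual
  rightWinsFirst-⊕-natGame-mono : ∀ g → StrictlyPFree g → ∀ m →
    rightWinsFirst (g ⊕ natGame m) ≤ rightWinsFirst (g ⊕ natGame (suc m))
  rightWinsFirst-⊕-natGame-mono (game a b ls rs) spf m =
    subst₂ _≤_ (sym (rightWinsFirst-⊕-natGame a b ls rs m))
               (sym (rightWinsFirst-⊕-natGame a b ls rs (suc m)))
      (∨-monoʳ-≤ (null rs) (∨-monoʳ-≤ b
        (someLeftLoses-⊕-natGame-mono (StrictlyPFree-rightOptions spf) m)))

  leftWinsFirst-⊕-natGame-anti : ∀ g → StrictlyPFree g → ∀ m →
    leftWinsFirst (g ⊕ natGame (suc m)) ≤ leftWinsFirst (g ⊕ natGame m)
  leftWinsFirst-⊕-natGame-anti g@(game a b ls rs) spf m =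
    subst (_≤ leftWinsFirst (g ⊕ natGame m)) (sym (leftWinsFirst-⊕-natGame-suc a b ls rs m))
      (∨-lub (≤-trans
               (∨-monoʳ-≤ a (someRightLoses-⊕-natGame-anti (StrictlyPFree-leftOptions spf) m))
               (leftWinsFirst-⊕-lowerBound a b ls rs (natGame m)))
             (⊕-natGame-≢𝓟 g spf m))

  ⊕-natGame-≢𝓟 : ∀ g → StrictlyPFree g → ∀ m →
    not (rightWinsFirst (g ⊕ natGame m)) ≤ leftWinsFirst (g ⊕ natGame m)
  ⊕-natGame-≢𝓟 g spf zero =
    subst (λ x → not (rightWinsFirst x) ≤ leftWinsFirst x) (sym (⊕-identityʳ g))
      (Equivalence.to (outcome≢𝓟⇔ g) (spf g here))
  ⊕-natGame-≢𝓟 g@(game a b ls rs) spf (suc m) =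
    ≤-trans (not-antimono-≤ (rightWinsFirst-⊕-natGame-mono g spf m))
      (subst (not (rightWinsFirst (g ⊕ natGame m)) ≤_)
             (sym (leftWinsFirst-⊕-natGame-suc a b ls rs m))
             (x≤y∨x _ _))

  someLeftLoses-⊕-natGame-mono : ∀ {rs} → All StrictlyPFree rs → ∀ m →
    someLeftLoses (addLeft rs (natGame m)) ≤ someLeftLoses (addLeft rs (natGame (suc m)))
  someLeftLoses-⊕-natGame-mono []                 m = ≤-refl
  someLeftLoses-⊕-natGame-mono {r ∷ _} (spf ∷ spfs) m =
    ∨-mono-≤ (not-antimono-≤ (leftWinsFirst-⊕-natGame-anti r spf m))
             (someLeftLoses-⊕-natGame-mono spfs m)

  someRightLoses-⊕-natGame-anti : ∀ {ls} → All StrictlyPFree ls → ∀ m →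
    someRightLoses (addLeft ls (natGame (suc m))) ≤ someRightLoses (addLeft ls (natGame m))
  someRightLoses-⊕-natGame-anti []                 m = ≤-refl
  someRightLoses-⊕-natGame-anti {l ∷ _} (spf ∷ spfs) m =
    ∨-mono-≤ (not-antimono-≤ (rightWinsFirst-⊕-natGame-mono l spf m))
             (someRightLoses-⊕-natGame-anti spfs m)

StrictlyPFree-⊕-natGame : ∀ {g} n → StrictlyPFree g → StrictlyPFree (g ⊕ natGame n)
StrictlyPFree-⊕-natGame {g} n spf k p with Subposition-⊕⁻ g (natGame n) p
... | g′ , h′ , q , r , refl with Subposition-natGame⁻ n r
... | m , refl = Equivalence.from (outcome≢𝓟⇔ (g′ ⊕ natGame m))
                   (⊕-natGame-≢𝓟 g′ (StrictlyPFree-sub spf q) m)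

mutual
  conj-involutive : ∀ g → conj (conj g) ≡ g
  conj-involutive (game a b ls rs) = cong₂ (game a b) (conjList-involutive ls) (conjList-involutive rs)

  conjList-involutive : ∀ xs → conjList (conjList xs) ≡ xs
  conjList-involutive []       = refl
  conjList-involutive (x ∷ xs) = cong₂ _∷_ (conj-involutive x) (conjList-involutive xs)

conjList-++ : ∀ xs ys → conjList (xs ++ ys) ≡ conjList xs ++ conjList ys
conjList-++ []       ys = refl
conjList-++ (x ∷ xs) ys = cong (conj x ∷_) (conjList-++ xs ys)

conjList-++-≡ : ∀ {xs ys xs′ ys′} →
  conjList xs ≡ xs′ → conjList ys ≡ ys′ → conjList (xs ++ ys) ≡ xs′ ++ ys′
conjList-++-≡ {xs} {ys} refl refl = conjList-++ xs ys

mutual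
  conj-⊕ : ∀ g h → conj (g ⊕ h) ≡ conj g ⊕ conj h
  conj-⊕ g@(game a b ls rs) h@(game c d ls′ rs′) =
    cong₂ (game (b ∨ d) (a ∨ c))
      (conjList-++-≡ (conjList-addLeft rs h) (conjList-addRight g rs′))
      (conjList-++-≡ (conjList-addLeft ls h) (conjList-addRight g ls′))

  conjList-addLeft : ∀ xs h → conjList (addLeft xs h) ≡ addLeft (conjList xs) (conj h)
  conjList-addLeft []       h = refl
  conjList-addLeft (x ∷ xs) h = cong₂ _∷_ (conj-⊕ x h) (conjList-addLeft xs h)

  conjList-addRight : ∀ g ys → conjList (addRight g ys) ≡ addRight (conj g) (conjList ys)
  conjList-addRight g []       = refl
  conjList-addRight g (y ∷ ys) = cong₂ _∷_ (conj-⊕ g y) (conjList-addRight g ys)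

mutual
  leftWinsFirst-conj : ∀ g → leftWinsFirst (conj g) ≡ rightWinsFirst g
  leftWinsFirst-conj (game a b ls [])       = refl
  leftWinsFirst-conj (game a b ls (r ∷ rs)) = cong (b ∨_) (someRightLoses-conjList (r ∷ rs))

  rightWinsFirst-conj : ∀ g → rightWinsFirst (conj g) ≡ leftWinsFirst g
  rightWinsFirst-conj (game a b [] rs)       = refl
  rightWinsFirst-conj (game a b (l ∷ ls) rs) = cong (a ∨_) (someLeftLoses-conjList (l ∷ ls))

  someRightLoses-conjList : ∀ xs → someRightLoses (conjList xs) ≡ someLeftLoses xs
  someRightLoses-conjList []       = refl
  someRightLoses-conjList (x ∷ xs) =
    cong₂ _∨_ (cong not (rightWinsFirst-conj x)) (someRightLoses-conjList xs)

  someLeftLoses-conjList : ∀ xs → someLeftLoses (conjList xs) ≡ someRightLoses xs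
  someLeftLoses-conjList []       = refl
  someLeftLoses-conjList (x ∷ xs) =
    cong₂ _∨_ (cong not (leftWinsFirst-conj x)) (someLeftLoses-conjList xs)

outcome-conj-≢𝓟 : ∀ g → outcome (conj g) ≢ 𝓟 → outcome g ≢ 𝓟
outcome-conj-≢𝓟 g o≢𝓟 = Equivalence.from (outcome≢𝓟⇔ g) (not-≤-swap conj≤)
  where
  conj≤ : not (leftWinsFirst g) ≤ rightWinsFirst g
  conj≤ = subst₂ (λ r l → not r ≤ l) (rightWinsFirst-conj g) (leftWinsFirst-conj g)
            (Equivalence.to (outcome≢𝓟⇔ (conj g)) o≢𝓟)

∈-conjList⁺ : ∀ {x xs} → x ∈ xs → conj x ∈ conjList xs
∈-conjList⁺ (here refl) = here refl
∈-conjList⁺ (there x∈)  = there (∈-conjList⁺ x∈)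

Subposition-conj : ∀ {g h} → Subposition g h → Subposition (conj g) (conj h)
Subposition-conj here        = here
Subposition-conj (viaL x∈ p) = viaR (∈-conjList⁺ x∈) (Subposition-conj p)
Subposition-conj (viaR x∈ p) = viaL (∈-conjList⁺ x∈) (Subposition-conj p)

StrictlyPFree-conj : ∀ {g} → StrictlyPFree g → StrictlyPFree (conj g)
StrictlyPFree-conj {g} spf h p =
  outcome-conj-≢𝓟 h (spf (conj h) (subst (λ x → Subposition x (conj h)) (conj-involutive g)
                                          (Subposition-conj p)))

lemma3p3 : (G : Game) (k : ℤ) → StrictlyPFree G → StrictlyPFree (G ⊕ intGame k)
lemma3p3 G (+ n)    spf = StrictlyPFree-⊕-natGame n spf
lemma3p3 G -[1+ n ] spf =
  subst StrictlyPFree conj-sum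
    (StrictlyPFree-conj (StrictlyPFree-⊕-natGame (suc n) (StrictlyPFree-conj spf)))
  where
  conj-sum : conj (conj G ⊕ natGame (suc n)) ≡ G ⊕ conj (natGame (suc n))
  conj-sum = trans (conj-⊕ (conj G) _) (cong (_⊕ _) (conj-involutive G))
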